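{- Let $G$ be a cograph with cotree $T_G$, and let $w_i$ be an interior vertex of $T_G$ having $t_i\geq 2$ leaf children, which are vertices $v$ of $G$ all of the same degree $\delta(v_i)$ in $G$. If $w_i$ is of $\cup$-type, then $\delta(v_i)$ is a Laplacian eigenvalue of $G$ with multiplicity $t_i-1$; if $w_i$ is of $\otimes$-type, then $\delta(v_i)+1$ is a Laplacian eigenvalue of $G$ with multiplicity $t_i-1$.
   Context: The Laplacian matrix of $G$ is $L(G)=\Delta(G)-A(G)$, with $\Delta(G)$ the diagonal matrix of degrees and $A(G)$ the adjacency matrix. A cograph is a graph with no induced path on four vertices. The cotree $T_G$ of a cograph $G$ is the rooted tree whose leaves are the vertices of $G$, whose interior vertices are each labelled $\cup$ or $\otimes$, every interior vertex having at least two children, with labels alternating along root-to-leaf paths, and such that two vertices of $G$ are adjacent iff their least common ancestor in $T_G$ is of $\otimes$-type. (Leaf children of a common $\cup$-vertex are duplicate vertices, $N(u)=N(v)$; leaf children of a common $\otimes$-vertex are coduplicate, $N[u]=N[v]$.) -}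

module Defs where

open import Data.Nat using (ℕ; zero; suc; _≤_)
open import Data.Fin using (Fin; _≟_)
open import Data.Bool using (Bool; true; false; if_then_else_)
open import Data.List using (List; []; _∷_; _++_; length; concat; tabulate; allFin; filterᵇ)
open import Data.List.Membership.Propositional using (_∈_)
open import Data.List.Relation.Binary.Permutation.Propositional using (_↭_)
open import Data.Integer using (+_)
open import Data.Rational using (ℚ; 0ℚ; 1ℚ; _+_; _*_; _-_; _/_)
open import Data.Product using (_×_; Σ)
open import Data.Unit using (⊤)
open import Data.Empty using (⊥)
open import Relation.Nullary using (¬_; does)
open import Relation.Binary.PropositionalEquality using (_≡_; _≢_)
open import Function.Bundles using (_⇔_)

Graph : ℕ → Set
Graph n = Fin n → Fin n → Bool

degree : ∀ {n} → Graph n → Fin n → ℕ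
degree {n} G u = length (filterᵇ (G u) (allFin n))

∑ : (k : ℕ) → (Fin k → ℚ) → ℚ
∑ zero    f = 0ℚ
∑ (suc k) f = f Fin.zero + ∑ k (λ i → f (Fin.suc i))

ℕtoℚ : ℕ → ℚ
ℕtoℚ d = (+ d) / 1

Matrix : ℕ → Set
Matrix n = Fin n → Fin n → ℚ

DegMat : ∀ {n} → Graph n → Matrix n
DegMat G u v = if does (u ≟ v) then ℕtoℚ (degree G u) else 0ℚ

AdjMat : ∀ {n} → Graph n → Matrix n
AdjMat G u v = if G u v then 1ℚ else 0ℚ

Laplacian : ∀ {n} → Graph n → Matrix n
Laplacian G u v = DegMat G u v - AdjMat G u v

_·_ : ∀ {n} → Matrix n → (Fin n → ℚ) → (Fin n → ℚ)
(M · x) u = ∑ _ (λ v → M u v * x v)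

-- x is an eigenvector of M for eigenvalue λ (x ≠ 0 is ensured by linear
-- independence below)
IsEigenvector : ∀ {n} → Matrix n → ℚ → (Fin n → ℚ) → Set
IsEigenvector M λ' x = ∀ u → (M · x) u ≡ λ' * x u

LinIndep : ∀ {n m} → (Fin m → Fin n → ℚ) → Set
LinIndep {n} {m} x =
  (c : Fin m → ℚ) → (∀ u → ∑ m (λ j → c j * x j u) ≡ 0ℚ) → ∀ j → c j ≡ 0ℚ

-- λ is an eigenvalue of M with multiplicity at least m:
-- there are m linearly independent eigenvectors for λ
-- (for the symmetric matrix L(G), geometric = algebraic multiplicity)
EigenvalueMultAtLeast : ∀ {n} → Matrix n → ℚ → ℕ → Set
EigenvalueMultAtLeast {n} M λ' m =
  Σ (Fin m → Fin n → ℚ) (λ x → LinIndep x × (∀ j → IsEigenvector M λ' (x j)))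

data Label : Set where
  ∪-type ⊗-type : Label

data Cotree (n : ℕ) : Set where
  leaf : Fin n → Cotree n
  node : Label → (k : ℕ) → (Fin k → Cotree n) → Cotree n

leaves : ∀ {n} → Cotree n → List (Fin n)
leaves (leaf v)     = v ∷ []
leaves (node l k f) = concat (tabulate (λ i → leaves (f i)))

AlternatesWith : ∀ {n} → Label → Cotree n → Set
AlternatesWith l (leaf v)       = ⊤
AlternatesWith l (node l' k f)  = ¬ (l ≡ l')

WellFormed : ∀ {n} → Cotree n → Set
WellFormed (leaf v)     = ⊤
WellFormed (node l k f) = (2 ≤ k) × (∀ i → AlternatesWith l (f i)) × (∀ i → WellFormed (f i))

data LcaLabel {n} (l : Label) : Cotree n → Fin n → Fin n → Set where
  inChild : ∀ {l' k f u v} (i : Fin k) →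
            LcaLabel l (f i) u v → LcaLabel l (node l' k f) u v
  here    : ∀ {k f u v} (i j : Fin k) → i ≢ j →
            u ∈ leaves (f i) → v ∈ leaves (f j) → LcaLabel l (node l k f) u v

IsCotreeOf : ∀ {n} → Cotree n → Graph n → Set
IsCotreeOf {n} T G =
  WellFormed T × (leaves T ↭ allFin n) ×
  (∀ u v → (G u v ≡ true) ⇔ LcaLabel ⊗-type T u v)

-- G is a cograph (has some cotree)
-- (a graph admits a cotree iff it has no induced P4; here the cotree is given)

-- subtree relation: S is a vertex of T
data _⊑_ {n} : Cotree n → Cotree n → Set where
  ⊑-refl  : ∀ {T} → T ⊑ T
  ⊑-child : ∀ {S l k f} (i : Fin k) → S ⊑ f i → S ⊑ node l k f

leafOf : ∀ {n} → Cotree n → List (Fin n)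
leafOf (leaf v)     = v ∷ []
leafOf (node _ _ _) = []

leafChildren : ∀ {n} → Cotree n → List (Fin n)
leafChildren (leaf v)     = []
leafChildren (node l k f) = concat (tabulate (λ i → leafOf (f i)))

eigOf : Label → ℕ → ℚ
eigOf ∪-type δ = ℕtoℚ δ
eigOf ⊗-type δ = ℕtoℚ (suc δ)

{-# OPTIONS --safe #-}
module Submission where

-- Two leaf children u ≠ v of the same cotree node are twins: for any other vertex w the least
-- common ancestor of w with u and of w with v is the same cotree vertex, so w sees both or
-- neither, while u and v are adjacent exactly when the node is of ⊗-type. Hence
-- L (e_u − e_v) = (δ + [⊗]) (e_u − e_v). Fixing one leaf child a, the vectors e_b − e_a for
-- the other leaf children b are linearly independent, since e_b − e_a is the only one that
-- does not vanish at b.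

open import Defs
open import Data.Nat using (ℕ; _≤_; _∸_)
open import Data.Fin using (Fin)
open import Data.List using (length)
open import Data.List.Membership.Propositional using (_∈_)
open import Relation.Binary.PropositionalEquality using (_≡_)

open import Data.Nat using (zero; suc)
import Data.Nat.Properties as ℕ
import Data.Nat.Coprimality as Coprimality
open import Data.Fin using (zero; suc; _≟_)
open import Data.Fin.Properties using (suc-injective)
open import Data.Bool using (Bool; true; false; if_then_else_)
open import Data.Bool.Properties using (¬-not)
import Data.Integer as ℤ
import Data.Integer.Properties as ℤ
open import Data.List using (List; []; _∷_; _++_; concat; tabulate; lookup)
open import Data.List.Membership.Propositional using (_∉_)
open import Data.List.Membership.Propositional.Properties
  using (∈-concat⁺′; ∈-concat⁻′; ∈-tabulate⁺; ∈-tabulate⁻; ∈-lookup)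
open import Data.List.Relation.Unary.All as All using ([]; _∷_)
import Data.List.Relation.Unary.All.Properties as All
import Data.List.Relation.Unary.AllPairs.Properties as AllPairs
open import Data.List.Relation.Unary.Any using (here; there)
open import Data.List.Relation.Unary.Unique.Propositional using (Unique; []; _∷_)
open import Data.List.Relation.Unary.Unique.Propositional.Properties using (allFin⁺; concat⁺)
open import Data.List.Relation.Binary.Disjoint.Propositional using (Disjoint)
open import Data.List.Relation.Binary.Permutation.Propositional using (↭-sym; ↭⇒↭ₛ)
open import Data.List.Relation.Binary.Permutation.Setoid.Properties using (Unique-resp-↭)
open import Data.Rational using (ℚ; 0ℚ; 1ℚ; _+_; _*_; _-_; -_; _/_)
import Data.Rational.Properties as ℚ
open import Data.Rational.Solver using (module +-*-Solver)
open import Data.Product using (_×_; _,_; Σ-syntax; proj₁; proj₂)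
open import Data.Empty using (⊥-elim)
open import Function using (_∘_; case_of_; Equivalence)
open import Relation.Nullary using (¬_; Dec; yes; no; does)
open import Relation.Nullary.Decidable using (dec-true; dec-false; decidable-stable)
open import Relation.Binary.PropositionalEquality
  using (_≢_; refl; sym; trans; cong; cong₂; subst; setoid; module ≡-Reasoning)

open +-*-Solver using (solve; _:+_; _:*_; _:-_; :-_; _:=_; con)
open ≡-Reasoning

∑-cong : ∀ k {f g : Fin k → ℚ} → (∀ j → f j ≡ g j) → ∑ k f ≡ ∑ k g
∑-cong zero    f≡g = refl
∑-cong (suc k) f≡g = cong₂ _+_ (f≡g zero) (∑-cong k (f≡g ∘ suc))

∑-zero : ∀ k {h : Fin k → ℚ} → (∀ j → h j ≡ 0ℚ) → ∑ k h ≡ 0ℚ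
∑-zero zero    h≡0 = refl
∑-zero (suc k) h≡0 = cong₂ _+_ (h≡0 zero) (∑-zero k (h≡0 ∘ suc))

∑-single : ∀ k {h : Fin k → ℚ} (i : Fin k) → (∀ j → j ≢ i → h j ≡ 0ℚ) → ∑ k h ≡ h i
∑-single (suc k) {h} zero h≡0 = begin
  h zero + ∑ k (h ∘ suc)  ≡⟨ cong (h zero +_) (∑-zero k (λ j → h≡0 (suc j) λ ())) ⟩
  h zero + 0ℚ             ≡⟨ ℚ.+-identityʳ (h zero) ⟩
  h zero                  ∎
∑-single (suc k) {h} (suc i) h≡0 = begin
  h zero + ∑ k (h ∘ suc)  ≡⟨ cong₂ _+_ (h≡0 zero λ ())
                                       (∑-single k i λ j j≢i → h≡0 (suc j) (j≢i ∘ suc-injective)) ⟩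
  0ℚ + h (suc i)          ≡⟨ ℚ.+-identityˡ (h (suc i)) ⟩
  h (suc i)               ∎

+--interchange : ∀ a b c d → (a - b) + (c - d) ≡ (a + c) - (b + d)
+--interchange = solve 4 (λ a b c d → (a :- b) :+ (c :- d) := (a :+ c) :- (b :+ d)) refl

*-distribˡ-- : ∀ a b c → a * (b - c) ≡ a * b - a * c
*-distribˡ-- = solve 3 (λ a b c → a :* (b :- c) := a :* b :- a :* c) refl

∑-distrib-- : ∀ k (f g : Fin k → ℚ) → ∑ k (λ j → f j - g j) ≡ ∑ k f - ∑ k g
∑-distrib-- zero    f g = refl
∑-distrib-- (suc k) f g = begin
  (f zero - g zero) + ∑ k (λ j → f (suc j) - g (suc j))
    ≡⟨ cong (f zero - g zero +_) (∑-distrib-- k (f ∘ suc) (g ∘ suc)) ⟩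
  (f zero - g zero) + (∑ k (f ∘ suc) - ∑ k (g ∘ suc))
    ≡⟨ +--interchange (f zero) (g zero) (∑ k (f ∘ suc)) (∑ k (g ∘ suc)) ⟩
  ∑ (suc k) f - ∑ (suc k) g
    ∎

_-ᵛ_ : ∀ {n} → (Fin n → ℚ) → (Fin n → ℚ) → Fin n → ℚ
(x -ᵛ y) z = x z - y z

basis : ∀ {n} → Fin n → Fin n → ℚ
basis a z = if does (a ≟ z) then 1ℚ else 0ℚ

basis-self : ∀ {n} (a : Fin n) → basis a a ≡ 1ℚ
basis-self a rewrite dec-true (a ≟ a) refl = refl

basis-other : ∀ {n} {a z : Fin n} → a ≢ z → basis a z ≡ 0ℚ
basis-other {a = a} {z} a≢z rewrite dec-false (a ≟ z) a≢z = refl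

·-distrib-ᵛ : ∀ {n} (M : Matrix n) (x y : Fin n → ℚ) w → (M · (x -ᵛ y)) w ≡ (M · x) w - (M · y) w
·-distrib-ᵛ M x y w = trans (∑-cong _ λ z → *-distribˡ-- (M w z) (x z) (y z))
                            (∑-distrib-- _ (λ z → M w z * x z) (λ z → M w z * y z))

·-basis : ∀ {n} (M : Matrix n) (a w : Fin n) → (M · basis a) w ≡ M w a
·-basis M a w = begin
  (M · basis a) w    ≡⟨ ∑-single _ a vanishes ⟩
  M w a * basis a a  ≡⟨ cong (M w a *_) (basis-self a) ⟩
  M w a * 1ℚ         ≡⟨ ℚ.*-identityʳ (M w a) ⟩
  M w a              ∎
  where
  vanishes : ∀ z → z ≢ a → M w z * basis a z ≡ 0ℚ
  vanishes z z≢a = trans (cong (M w z *_) (basis-other (z≢a ∘ sym))) (ℚ.*-zeroʳ (M w z))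

·-basis-difference : ∀ {n} (M : Matrix n) (a b w : Fin n) → (M · (basis a -ᵛ basis b)) w ≡ M w a - M w b
·-basis-difference M a b w =
  trans (·-distrib-ᵛ M (basis a) (basis b) w) (cong₂ _-_ (·-basis M a w) (·-basis M b w))

lookup-injective : ∀ {a} {A : Set a} {xs : List A} → Unique xs →
                   ∀ i j → lookup xs i ≡ lookup xs j → i ≡ j
lookup-injective (x∉xs ∷ xs!) zero    zero    _  = refl
lookup-injective (x∉xs ∷ xs!) zero    (suc j) eq = ⊥-elim (All.lookup x∉xs (∈-lookup j) eq)
lookup-injective (x∉xs ∷ xs!) (suc i) zero    eq = ⊥-elim (All.lookup x∉xs (∈-lookup i) (sym eq))
lookup-injective (x∉xs ∷ xs!) (suc i) (suc j) eq = cong suc (lookup-injective xs! i j eq)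

LinIndep-basisDifferences : ∀ {n} {a : Fin n} {bs : List (Fin n)} → Unique (a ∷ bs) →
                            LinIndep (λ j → basis (lookup bs j) -ᵛ basis a)
LinIndep-basisDifferences {n} {a} {bs} (a∉bs ∷ bs!) c ∑≡0 j = begin
  c j                ≡⟨ ℚ.*-identityʳ (c j) ⟨
  c j * (1ℚ - 0ℚ)    ≡⟨ cong (c j *_) (cong₂ _-_ (basis-self (b j)) (basis-other a≢bⱼ)) ⟨
  coefficient j      ≡⟨ ∑-single _ j vanishes ⟨
  ∑ _ coefficient    ≡⟨ ∑≡0 (b j) ⟩
  0ℚ                 ∎
  where
  b : Fin (length bs) → Fin n
  b = lookup bs
  a≢bⱼ : a ≢ b j
  a≢bⱼ = All.lookup a∉bs (∈-lookup j)
  coefficient : Fin (length bs) → ℚ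
  coefficient j′ = c j′ * (basis (b j′) (b j) - basis a (b j))
  vanishes : ∀ j′ → j′ ≢ j → coefficient j′ ≡ 0ℚ
  vanishes j′ j′≢j rewrite basis-other (j′≢j ∘ lookup-injective bs! j′ j) | basis-other a≢bⱼ =
    ℚ.*-zeroʳ (c j′)

eigenvalueMultAtLeast-basisDifferences :
  ∀ {n} (M : Matrix n) (μ : ℚ) {xs : List (Fin n)} → Unique xs →
  (∀ {u v} → u ∈ xs → v ∈ xs → u ≢ v → IsEigenvector M μ (basis u -ᵛ basis v)) →
  EigenvalueMultAtLeast M μ (length xs ∸ 1)
eigenvalueMultAtLeast-basisDifferences M μ {[]} _ _ = (λ ()) , (λ _ _ ()) , (λ ())
eigenvalueMultAtLeast-basisDifferences M μ {a ∷ bs} xs!@(a∉bs ∷ _) eigenvector =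
  (λ j → basis (lookup bs j) -ᵛ basis a) ,
  LinIndep-basisDifferences xs! ,
  (λ j → eigenvector (there (∈-lookup j)) (here refl) (All.lookup a∉bs (∈-lookup j) ∘ sym))

Loopless : ∀ {n} → Graph n → Set
Loopless G = ∀ w → G w w ≡ false

Laplacian-diagonal : ∀ {n} (G : Graph n) → Loopless G → ∀ w → Laplacian G w w ≡ ℕtoℚ (degree G w)
Laplacian-diagonal G loopless w rewrite dec-true (w ≟ w) refl | loopless w = ℚ.+-identityʳ _

Laplacian-offDiagonal : ∀ {n} (G : Graph n) {w z} → w ≢ z → Laplacian G w z ≡ - AdjMat G w z
Laplacian-offDiagonal G {w} {z} w≢z rewrite dec-false (w ≟ z) w≢z = ℚ.+-identityˡ _

twin-eigenvector : ∀ {n} (G : Graph n) → Loopless G → ∀ {u v δ} → u ≢ v →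
                   G u v ≡ G v u → (∀ w → w ≢ u → w ≢ v → G w u ≡ G w v) →
                   degree G u ≡ δ → degree G v ≡ δ →
                   IsEigenvector (Laplacian G) (ℕtoℚ δ + AdjMat G u v) (basis u -ᵛ basis v)
twin-eigenvector {n} G loopless {u} {v} {δ} u≢v symmetric sameNeighbours deg-u deg-v w =
  trans (·-basis-difference L u v w) (row (w ≟ u) (w ≟ v))
  where
  L A : Matrix n
  L = Laplacian G
  A = AdjMat G
  d μ : ℚ
  d = ℕtoℚ δ
  μ = d + A u v
  diagonal : ∀ {x} → degree G x ≡ δ → L x x ≡ d
  diagonal {x} deg-x = trans (Laplacian-diagonal G loopless x) (cong ℕtoℚ deg-x)
  row : Dec (w ≡ u) → Dec (w ≡ v) → L w u - L w v ≡ μ * (basis u w - basis v w)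
  row (yes refl) _ = begin
    L u u - L u v
      ≡⟨ cong₂ _-_ (diagonal deg-u) (Laplacian-offDiagonal G u≢v) ⟩
    d - - A u v
      ≡⟨ solve 2 (λ d a → d :- (:- a) := (d :+ a) :* (con 1ℚ :- con 0ℚ)) refl d (A u v) ⟩
    μ * (1ℚ - 0ℚ)
      ≡⟨ cong (μ *_) (cong₂ _-_ (basis-self u) (basis-other (u≢v ∘ sym))) ⟨
    μ * (basis u u - basis v u)
      ∎
  row (no _) (yes refl) = begin
    L v u - L v v
      ≡⟨ cong₂ _-_ (Laplacian-offDiagonal G (u≢v ∘ sym)) (diagonal deg-v) ⟩
    - A v u - d
      ≡⟨ cong (λ b → - (if b then 1ℚ else 0ℚ) - d) symmetric ⟨
    - A u v - d
      ≡⟨ solve 2 (λ d a → (:- a) :- d := (d :+ a) :* (con 0ℚ :- con 1ℚ)) refl d (A u v) ⟩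
    μ * (0ℚ - 1ℚ)
      ≡⟨ cong (μ *_) (cong₂ _-_ (basis-other u≢v) (basis-self v)) ⟨
    μ * (basis u v - basis v v)
      ∎
  row (no w≢u) (no w≢v) = begin
    L w u - L w v
      ≡⟨ cong₂ _-_ (Laplacian-offDiagonal G w≢u) (Laplacian-offDiagonal G w≢v) ⟩
    - A w u - - A w v
      ≡⟨ cong (λ b → - A w u - - (if b then 1ℚ else 0ℚ)) (sameNeighbours w w≢u w≢v) ⟨
    - A w u - - A w u
      ≡⟨ ℚ.+-inverseʳ (- A w u) ⟩
    0ℚ
      ≡⟨ ℚ.*-zeroʳ μ ⟨
    μ * (0ℚ - 0ℚ)
      ≡⟨ cong (μ *_) (cong₂ _-_ (basis-other (w≢u ∘ sym)) (basis-other (w≢v ∘ sym))) ⟨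
    μ * (basis u w - basis v w)
      ∎

Unique-++⁻ : ∀ {a} {A : Set a} (xs : List A) {ys} → Unique (xs ++ ys) →
             Unique xs × Unique ys × Disjoint xs ys
Unique-++⁻ []       ys!              = [] , ys! , λ ()
Unique-++⁻ (x ∷ xs) (x∉xs++ys ∷ xs++ys!) with Unique-++⁻ xs xs++ys!
... | xs! , ys! , disjoint =
  All.++⁻ˡ xs x∉xs++ys ∷ xs! , ys! ,
  λ { (here refl , x∈ys) → All.lookup (All.++⁻ʳ xs x∉xs++ys) x∈ys refl
    ; (there v∈xs , v∈ys) → disjoint (v∈xs , v∈ys) }

∈-concat-tabulate⁺ : ∀ {a} {A : Set a} {k} (g : Fin k → List A) i {x} →
                     x ∈ g i → x ∈ concat (tabulate g)
∈-concat-tabulate⁺ g i x∈gᵢ = ∈-concat⁺′ x∈gᵢ (∈-tabulate⁺ i)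

∈-concat-tabulate⁻ : ∀ {a} {A : Set a} {k} (g : Fin k → List A) {x} → x ∈ concat (tabulate g) →
                     Σ[ i ∈ Fin k ] x ∈ g i
∈-concat-tabulate⁻ g x∈ with ∈-concat⁻′ (tabulate g) x∈
... | _ , x∈xs , xs∈ with ∈-tabulate⁻ xs∈
... | i , refl = i , x∈xs

Unique-concat-tabulate⁻ : ∀ {a} {A : Set a} {k} (g : Fin k → List A) → Unique (concat (tabulate g)) →
                          (∀ i → Unique (g i)) × (∀ {i j} → i ≢ j → Disjoint (g i) (g j))
Unique-concat-tabulate⁻ {k = zero} g _ = (λ ()) , λ { {()} }
Unique-concat-tabulate⁻ {k = suc k} g g!
  with Unique-++⁻ (g zero) g!
... | g₀! , rest! , g₀-rest-disjoint
  with Unique-concat-tabulate⁻ (g ∘ suc) rest!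
... | gₛ! , gₛ-disjoint = unique , disjoint
  where
  unique : ∀ i → Unique (g i)
  unique zero    = g₀!
  unique (suc i) = gₛ! i
  disjoint : ∀ {i j} → i ≢ j → Disjoint (g i) (g j)
  disjoint {zero}  {zero}  0≢0 = ⊥-elim (0≢0 refl)
  disjoint {zero}  {suc j} _   (x∈g₀ , x∈gⱼ) =
    g₀-rest-disjoint (x∈g₀ , ∈-concat-tabulate⁺ (g ∘ suc) j x∈gⱼ)
  disjoint {suc i} {zero}  _   (x∈gᵢ , x∈g₀) =
    g₀-rest-disjoint (x∈g₀ , ∈-concat-tabulate⁺ (g ∘ suc) i x∈gᵢ)
  disjoint {suc i} {suc j} i≢j = gₛ-disjoint (i≢j ∘ cong suc)

module _ {n : ℕ} where

  data DistinctLeaves : Cotree n → Set where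
    leaf : ∀ {v} → DistinctLeaves (leaf v)
    node : ∀ {l k f} → (∀ {i j} → i ≢ j → Disjoint (leaves (f i)) (leaves (f j))) →
           (∀ i → DistinctLeaves (f i)) → DistinctLeaves (node l k f)

  Unique⇒DistinctLeaves : ∀ T → Unique (leaves T) → DistinctLeaves T
  Unique⇒DistinctLeaves (leaf _)     _  = leaf
  Unique⇒DistinctLeaves (node _ k f) T! =
    let children! , disjoint = Unique-concat-tabulate⁻ (leaves ∘ f) T!
    in  node disjoint λ i → Unique⇒DistinctLeaves (f i) (children! i)

  sameChild : ∀ {l k f x} {i j : Fin k} → DistinctLeaves (node l k f) →
              x ∈ leaves (f i) → x ∈ leaves (f j) → i ≡ j
  sameChild {i = i} {j} (node disjoint _) x∈fᵢ x∈fⱼ =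
    decidable-stable (i ≟ j) λ i≢j → disjoint i≢j (x∈fᵢ , x∈fⱼ)

  ⊑-leaves : ∀ {S T : Cotree n} {x} → S ⊑ T → x ∈ leaves S → x ∈ leaves T
  ⊑-leaves ⊑-refl                 x∈ = x∈
  ⊑-leaves (⊑-child {f = f} i S⊑) x∈ = ∈-concat-tabulate⁺ (leaves ∘ f) i (⊑-leaves S⊑ x∈)

  ⊑-DistinctLeaves : ∀ {S T : Cotree n} → S ⊑ T → DistinctLeaves T → DistinctLeaves S
  ⊑-DistinctLeaves ⊑-refl         T-distinct          = T-distinct
  ⊑-DistinctLeaves (⊑-child i S⊑) (node _ f-distinct) = ⊑-DistinctLeaves S⊑ (f-distinct i)

  ⊑-LcaLabel : ∀ {m} {S T : Cotree n} {u v} → S ⊑ T → LcaLabel m S u v → LcaLabel m T u v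
  ⊑-LcaLabel ⊑-refl         lca = lca
  ⊑-LcaLabel (⊑-child i S⊑) lca = inChild i (⊑-LcaLabel S⊑ lca)

  LcaLabel-leaves : ∀ {m} {S : Cotree n} {u v} → LcaLabel m S u v → u ∈ leaves S × v ∈ leaves S
  LcaLabel-leaves (inChild {f = f} i lca) =
    let u∈fᵢ , v∈fᵢ = LcaLabel-leaves lca
    in  ∈-concat-tabulate⁺ (leaves ∘ f) i u∈fᵢ , ∈-concat-tabulate⁺ (leaves ∘ f) i v∈fᵢ
  LcaLabel-leaves (here {f = f} i j _ u∈fᵢ v∈fⱼ) =
    ∈-concat-tabulate⁺ (leaves ∘ f) i u∈fᵢ , ∈-concat-tabulate⁺ (leaves ∘ f) j v∈fⱼ

  LcaLabel-irrefl : ∀ {m} {S : Cotree n} {w} → DistinctLeaves S → ¬ LcaLabel m S w w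
  LcaLabel-irrefl (node _ f-distinct) (inChild i lca)          = LcaLabel-irrefl (f-distinct i) lca
  LcaLabel-irrefl (node disjoint _)   (here i j i≢j w∈fᵢ w∈fⱼ) = disjoint i≢j (w∈fᵢ , w∈fⱼ)

  LcaLabel-unique : ∀ {m m′} {S : Cotree n} {u v} → DistinctLeaves S →
                    LcaLabel m S u v → LcaLabel m′ S u v → m ≡ m′
  LcaLabel-unique S-distinct@(node _ f-distinct) (inChild i lca) (inChild i′ lca′)
    with sameChild S-distinct (proj₁ (LcaLabel-leaves lca)) (proj₁ (LcaLabel-leaves lca′))
  ... | refl = LcaLabel-unique (f-distinct i) lca lca′
  LcaLabel-unique S-distinct (inChild i lca) (here i′ j′ i′≢j′ u∈ v∈) =
    let u∈fᵢ , v∈fᵢ = LcaLabel-leaves lca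
    in  ⊥-elim (i′≢j′ (trans (sym (sameChild S-distinct u∈fᵢ u∈)) (sameChild S-distinct v∈fᵢ v∈)))
  LcaLabel-unique S-distinct (here i j i≢j u∈ v∈) (inChild i′ lca′) =
    let u∈fᵢ′ , v∈fᵢ′ = LcaLabel-leaves lca′
    in  ⊥-elim (i≢j (trans (sameChild S-distinct u∈ u∈fᵢ′) (sameChild S-distinct v∈fᵢ′ v∈)))
  LcaLabel-unique _ (here _ _ _ _ _) (here _ _ _ _ _) = refl

  LcaLabel-siblings : ∀ {m l k f} {i j : Fin k} {S : Cotree n} {a b w} →
                      node l k f ⊑ S → DistinctLeaves S →
                      a ∈ leaves (f i) → b ∈ leaves (f j) → w ∉ leaves (f i) → w ∉ leaves (f j) →
                      LcaLabel m S w a → LcaLabel m S w b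
  LcaLabel-siblings ⊑-refl S-distinct a∈fᵢ _ w∉fᵢ _ (inChild i′ lca)
    with sameChild S-distinct (proj₂ (LcaLabel-leaves lca)) a∈fᵢ
  ... | refl = ⊥-elim (w∉fᵢ (proj₁ (LcaLabel-leaves lca)))
  LcaLabel-siblings {j = j} ⊑-refl S-distinct a∈fᵢ b∈fⱼ _ w∉fⱼ (here i′ j′ _ w∈fᵢ′ a∈fⱼ′)
    with sameChild S-distinct a∈fⱼ′ a∈fᵢ
  ... | refl = here i′ j (λ { refl → w∉fⱼ w∈fᵢ′ }) w∈fᵢ′ b∈fⱼ
  LcaLabel-siblings {f = f} {i} (⊑-child _ S⊑) S-distinct@(node _ f-distinct) a∈fᵢ b∈fⱼ w∉fᵢ w∉fⱼ
                    (inChild i′ lca)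
    with sameChild S-distinct (proj₂ (LcaLabel-leaves lca))
                              (⊑-leaves S⊑ (∈-concat-tabulate⁺ (leaves ∘ f) i a∈fᵢ))
  ... | refl = inChild i′ (LcaLabel-siblings S⊑ (f-distinct i′) a∈fᵢ b∈fⱼ w∉fᵢ w∉fⱼ lca)
  LcaLabel-siblings {f = f} {i} {j} (⊑-child _ S⊑) S-distinct a∈fᵢ b∈fⱼ _ _
                    (here i′ j′ i′≢j′ w∈ a∈fⱼ′)
    with sameChild S-distinct a∈fⱼ′ (⊑-leaves S⊑ (∈-concat-tabulate⁺ (leaves ∘ f) i a∈fᵢ))
  ... | refl = here i′ j′ i′≢j′ w∈ (⊑-leaves S⊑ (∈-concat-tabulate⁺ (leaves ∘ f) j b∈fⱼ))

  leafOf-unique : ∀ (t : Cotree n) → Unique (leafOf t)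
  leafOf-unique (leaf _)     = [] ∷ []
  leafOf-unique (node _ _ _) = []

  leafOf⊆leaves : ∀ (t : Cotree n) {x} → x ∈ leafOf t → x ∈ leaves t
  leafOf⊆leaves (leaf _) x∈ = x∈

  leafOf-sole : ∀ (t : Cotree n) {x w} → x ∈ leafOf t → w ∈ leaves t → w ≡ x
  leafOf-sole (leaf _) (here refl) (here refl) = refl

  leafChildren-unique : ∀ {l k f} → DistinctLeaves (node l k f) → Unique (leafChildren (node l k f))
  leafChildren-unique {f = f} (node disjoint _) =
    concat⁺ (All.tabulate⁺ (leafOf-unique ∘ f))
            (AllPairs.tabulate⁺ λ i≢j (x∈fᵢ , x∈fⱼ) →
              disjoint i≢j (leafOf⊆leaves (f _) x∈fᵢ , leafOf⊆leaves (f _) x∈fⱼ))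

true⇔true⇒≡ : ∀ {x y : Bool} → (x ≡ true → y ≡ true) → (y ≡ true → x ≡ true) → x ≡ y
true⇔true⇒≡ {false} {false} _   _   = refl
true⇔true⇒≡ {false} {true}  _   y⇒x = y⇒x refl
true⇔true⇒≡ {true}  {false} x⇒y _   = sym (x⇒y refl)
true⇔true⇒≡ {true}  {true}  _   _   = refl

is⊗ : Label → Bool
is⊗ ∪-type = false
is⊗ ⊗-type = true

ℕtoℚ-suc : ∀ d → ℕtoℚ (suc d) ≡ ℕtoℚ d + 1ℚ
ℕtoℚ-suc d = sym (begin
  ℕtoℚ d + 1ℚ
    ≡⟨ cong (_+ 1ℚ) (ℚ.normalize-coprime {d} {0} (Coprimality.sym (Coprimality.1-coprimeTo d))) ⟩
  (ℤ.+ d ℤ.* ℤ.+ 1 ℤ.+ ℤ.+ 1) / 1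
    ≡⟨ cong (λ z → (z ℤ.+ ℤ.+ 1) / 1) (ℤ.*-identityʳ (ℤ.+ d)) ⟩
  (ℤ.+ d ℤ.+ ℤ.+ 1) / 1
    ≡⟨ cong (λ m → ℤ.+ m / 1) (ℕ.+-comm d 1) ⟩
  ℕtoℚ (suc d)
    ∎)

eigOf-is⊗ : ∀ l δ → eigOf l δ ≡ ℕtoℚ δ + (if is⊗ l then 1ℚ else 0ℚ)
eigOf-is⊗ ∪-type δ = sym (ℚ.+-identityʳ (ℕtoℚ δ))
eigOf-is⊗ ⊗-type δ = ℕtoℚ-suc δ

module CotreeOf {n} {G : Graph n} {T : Cotree n} (cotree : IsCotreeOf T G) where

  distinctLeaves : DistinctLeaves T
  distinctLeaves = Unique⇒DistinctLeaves T
    (Unique-resp-↭ (setoid (Fin n)) (↭⇒↭ₛ (↭-sym (proj₁ (proj₂ cotree)))) (allFin⁺ n))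

  adjacent⇒LcaLabel⊗ : ∀ {u v} → G u v ≡ true → LcaLabel ⊗-type T u v
  adjacent⇒LcaLabel⊗ = Equivalence.to (proj₂ (proj₂ cotree) _ _)

  LcaLabel⊗⇒adjacent : ∀ {u v} → LcaLabel ⊗-type T u v → G u v ≡ true
  LcaLabel⊗⇒adjacent = Equivalence.from (proj₂ (proj₂ cotree) _ _)

  loopless : Loopless G
  loopless w = ¬-not (LcaLabel-irrefl distinctLeaves ∘ adjacent⇒LcaLabel⊗)

  adjacency-LcaLabel : ∀ {m u v} → LcaLabel m T u v → G u v ≡ is⊗ m
  adjacency-LcaLabel {⊗-type} lca = LcaLabel⊗⇒adjacent lca
  adjacency-LcaLabel {∪-type} lca = ¬-not λ adjacent →
    case LcaLabel-unique distinctLeaves lca (adjacent⇒LcaLabel⊗ adjacent) of λ ()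

  module _ {l k f} (S⊑T : node l k f ⊑ T) where

    leafChild : ∀ {u} → u ∈ leafChildren (node l k f) → Σ[ i ∈ Fin k ] u ∈ leafOf (f i)
    leafChild = ∈-concat-tabulate⁻ (leafOf ∘ f)

    leafChildren-adjacency : ∀ {u v} → u ∈ leafChildren (node l k f) → v ∈ leafChildren (node l k f) →
                             u ≢ v → G u v ≡ is⊗ l
    leafChildren-adjacency u∈ v∈ u≢v with leafChild u∈ | leafChild v∈
    ... | i , u∈fᵢ | j , v∈fⱼ =
      adjacency-LcaLabel
        (⊑-LcaLabel S⊑T (here i j i≢j (leafOf⊆leaves (f i) u∈fᵢ) (leafOf⊆leaves (f j) v∈fⱼ)))
      where
      i≢j : i ≢ j
      i≢j refl = u≢v (sym (leafOf-sole (f i) u∈fᵢ (leafOf⊆leaves (f i) v∈fⱼ)))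

    leafChildren-sameNeighbours : ∀ {u v} → u ∈ leafChildren (node l k f) →
                                  v ∈ leafChildren (node l k f) → ∀ w → w ≢ u → w ≢ v → G w u ≡ G w v
    leafChildren-sameNeighbours u∈ v∈ w w≢u w≢v with leafChild u∈ | leafChild v∈
    ... | i , u∈fᵢ | j , v∈fⱼ =
      true⇔true⇒≡ (transfer u∈fᵢ v∈fⱼ w≢u w≢v) (transfer v∈fⱼ u∈fᵢ w≢v w≢u)
      where
      transfer : ∀ {a b i j} → a ∈ leafOf (f i) → b ∈ leafOf (f j) → w ≢ a → w ≢ b →
                 G w a ≡ true → G w b ≡ true
      transfer {i = i} {j} a∈fᵢ b∈fⱼ w≢a w≢b =
        LcaLabel⊗⇒adjacent
        ∘ LcaLabel-siblings S⊑T distinctLeaves (leafOf⊆leaves (f i) a∈fᵢ) (leafOf⊆leaves (f j) b∈fⱼ)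
            (w≢a ∘ leafOf-sole (f i) a∈fᵢ) (w≢b ∘ leafOf-sole (f j) b∈fⱼ)
        ∘ adjacent⇒LcaLabel⊗

lemma2p1 : ∀ {n} (G : Graph n) (T : Cotree n) → IsCotreeOf T G →
           (l : Label) (k : ℕ) (f : Fin k → Cotree n) → node l k f ⊑ T →
           (δ : ℕ) → 2 ≤ length (leafChildren (node l k f)) →
           (∀ v → v ∈ leafChildren (node l k f) → degree G v ≡ δ) →
           EigenvalueMultAtLeast (Laplacian G) (eigOf l δ)
             (length (leafChildren (node l k f)) ∸ 1)
lemma2p1 G T cotree l k f S⊑T δ _ degree≡δ =
  eigenvalueMultAtLeast-basisDifferences (Laplacian G) (eigOf l δ)
    (leafChildren-unique (⊑-DistinctLeaves S⊑T distinctLeaves)) eigenvector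
  where
  open CotreeOf cotree
  eigenvector : ∀ {u v} → u ∈ leafChildren (node l k f) → v ∈ leafChildren (node l k f) → u ≢ v →
                IsEigenvector (Laplacian G) (eigOf l δ) (basis u -ᵛ basis v)
  eigenvector {u} {v} u∈ v∈ u≢v =
    subst (λ μ → IsEigenvector (Laplacian G) μ (basis u -ᵛ basis v)) (sym eigenvalue)
      (twin-eigenvector G loopless u≢v (trans adjacency (sym adjacency′))
        (leafChildren-sameNeighbours S⊑T u∈ v∈) (degree≡δ u u∈) (degree≡δ v v∈))
    where
    adjacency : G u v ≡ is⊗ l
    adjacency = leafChildren-adjacency S⊑T u∈ v∈ u≢v
    adjacency′ : G v u ≡ is⊗ l
    adjacency′ = leafChildren-adjacency S⊑T v∈ u∈ (u≢v ∘ sym)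
    eigenvalue : eigOf l δ ≡ ℕtoℚ δ + AdjMat G u v
    eigenvalue = trans (eigOf-is⊗ l δ) (cong (λ b → ℕtoℚ δ + (if b then 1ℚ else 0ℚ)) (sym adjacency))
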